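{- Let $\vec T$ be a directed tree with $t$ edges that contains no directed path of length $2$. Then there exists $\delta>0$ such that the following holds: if $f(m)\to\infty$ as $m\to\infty$ and, for each $m$, $\vec G_m$ is a directed graph on $m$ vertices with $f(m)\cdot m$ edges, then for all sufficiently large $m$, $\vec G_m$ contains at least $\delta f(m)^t m$ copies of $\vec T$.
   Context: A directed tree is a directed graph whose underlying undirected graph is a tree; a directed path of length $2$ is a pair of edges $\vec{uv},\vec{vw}$. A copy of $\vec T$ in $\vec G$ is a subgraph of $\vec G$ isomorphic to $\vec T$ as a directed graph. -}

module Defs where

open import Data.Nat using (ℕ; zero; suc; _∸_; _≤_)
open import Data.Nat as ℕ using ()
open import Data.Fin using (Fin)
open import Data.Bool using (Bool; true; false; if_then_else_)
open import Data.List using (List; map; allFin)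
open import Data.Nat.ListAction using (sum)
open import Data.Product using (Σ; ∃; ∃-syntax; _×_)
open import Data.Sum using (_⊎_)
open import Data.Integer using (+_)
open import Data.Rational using (ℚ; 1ℚ; _*_; _/_)
open import Relation.Binary.PropositionalEquality using (_≡_)
open import Relation.Binary.Construct.Closure.ReflexiveTransitive using (Star)
open import Relation.Nullary using (¬_)
open import Function using (_⇔_)

-- Antiparallel pairs u → v, v → u are allowed (as in a general digraph).
record Digraph (n : ℕ) : Set where
  field
    adj      : Fin n → Fin n → Bool
    loopless : ∀ v → adj v v ≡ false
open Digraph public

Edge : ∀ {n} → Digraph n → Fin n → Fin n → Set
Edge G u v = adj G u v ≡ true

edgeCount : ∀ {n} → Digraph n → ℕ
edgeCount {n} G =
  sum (map (λ u → sum (map (λ v → if adj G u v then 1 else 0) (allFin n))) (allFin n))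

UAdj : ∀ {n} → Digraph n → Fin n → Fin n → Set
UAdj G u v = Edge G u v ⊎ Edge G v u

-- A directed tree: the underlying undirected graph is a tree, i.e. it is
-- a simple graph (no antiparallel pair of edges, which would become a
-- double edge), it has at least one vertex, it is connected, and it has
-- (number of vertices - 1) edges.
IsDirectedTree : ∀ {n} → Digraph n → Set
IsDirectedTree {n} T =
  1 ≤ n
  × (∀ u v → Edge T u v → ¬ Edge T v u)
  × (∀ u v → Star (UAdj T) u v)
  × edgeCount T ≡ n ∸ 1

NoDirectedP2 : ∀ {n} → Digraph n → Set
NoDirectedP2 T = ∀ u v w → Edge T u v → ¬ Edge T v w

-- A copy of T (on Fin n) in G (on Fin m): a subgraph H = (W, F) of G,
-- W a vertex subset and F an edge subset of G with endpoints in W,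
-- together with an isomorphism of digraphs T ≅ H, given as a bijection
-- φ : Fin n → W preserving and reflecting edges.
record Copy {n m : ℕ} (T : Digraph n) (G : Digraph m) : Set where
  field
    W   : Fin m → Bool
    F   : Fin m → Fin m → Bool
    sub : ∀ u v → F u v ≡ true → Edge G u v × W u ≡ true × W v ≡ true
    φ   : Fin n → Fin m
    φ-inj  : ∀ i j → φ i ≡ φ j → i ≡ j
    φ-onto : ∀ v → (W v ≡ true ⇔ (∃[ i ] φ i ≡ v))
    φ-iso  : ∀ i j → F (φ i) (φ j) ≡ adj T i j
open Copy public

SameSubgraph : ∀ {n m} {T : Digraph n} {G : Digraph m} → Copy T G → Copy T G → Set
SameSubgraph c d = (∀ v → W c v ≡ W d v) × (∀ u v → F c u v ≡ F d u v)

AtLeastCopies : ∀ {n m} → ℕ → Digraph n → Digraph m → Set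
AtLeastCopies N T G =
  Σ (Fin N → Copy T G) λ c → ∀ i j → SameSubgraph (c i) (c j) → i ≡ j

ℕtoℚ : ℕ → ℚ
ℕtoℚ k = + k / 1

_^ℚ_ : ℚ → ℕ → ℚ
q ^ℚ zero  = 1ℚ
q ^ℚ suc k = q * (q ^ℚ k)

-- Write E for the number of edges of G and d = ⌊E/8m⌋. Deleting, one at a time, vertices of
-- small out-degree from a left copy L of V(G) and vertices of small in-degree from a right
-- copy R leaves a pair in which every vertex of L has d out-neighbours in R and every vertex
-- of R has d in-neighbours in L, at the cost of at most 2dm ≤ E/4 edges. As T has no
-- directed path of length 2, each vertex of T is either a source or a sink; we embed sources
-- into L and sinks into R along a search order of T starting at a source, each new vertex
-- being adjacent to exactly one earlier vertex. Greedily this yields at least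
-- (e(L,R) − m)(d − n)^(t−1) ≥ c E^t / m^(t−1) injective homomorphisms T → G, and each copy
-- of T is the image of at most n^n of them.
module Submission where

module Counting where

  open import Defs

  open import Data.Bool using (Bool; true; false; if_then_else_; _∧_)
  import Data.Bool as Bool
  open import Data.Fin using (Fin; zero; suc; toℕ; fromℕ<; punchIn)
  open import Data.Fin.Properties
    using (injective⇒≤; punchInᵢ≢i; any?; all?; ¬∀⟶∃¬; toℕ-injective; toℕ-fromℕ<; toℕ<n; _≟_)
  open import Data.List
    using (List; []; _∷_; length; map; filter; allFin; upTo; concatMap; deduplicate)
  import Data.List as List
  open import Data.List.Properties
    using (length-++; length-map; length-tabulate; length-upTo; length-filter; map-cong; map-∘)
  open import Data.List.Membership.Propositional using (_∈_; _∉_; find)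
  open import Data.List.Membership.Propositional.Properties
    using ( ∈-lookup; ∈-map⁺; ∈-map⁻; ∈-filter⁺; ∈-filter⁻; ∈-allFin; ∈-upTo⁺; ∈-tabulate⁻
          ; ∈-concatMap⁺; ∈-concatMap⁻; ∈-deduplicate⁺; ∈-deduplicate⁻)
  open import Data.List.Membership.Setoid.Properties using (index-injective)
  open import Data.List.Relation.Binary.Disjoint.Propositional using (Disjoint)
  open import Data.List.Relation.Binary.Subset.Propositional using (_⊆_)
  open import Data.List.Relation.Unary.All as All using (All)
  import Data.List.Relation.Unary.All.Properties as All
  open import Data.List.Relation.Unary.Any as Any using (here; there)
  open import Data.List.Relation.Unary.AllPairs using ([]; _∷_)
  open import Data.List.Relation.Unary.Unique.Propositional using (Unique)
  open import Data.List.Relation.Unary.Unique.Propositional.Properties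
    using (++⁺; map⁺; filter⁺; tabulate⁺; allFin⁺)
  open import Data.List.Relation.Unary.Unique.DecPropositional.Properties using (deduplicate-!)
  open import Data.Nat using (ℕ; zero; suc; _+_; _*_; _∸_; _^_; _≤_; _<_; _<?_; z≤n; s≤s; s≤s⁻¹)
  open import Data.Nat.ListAction using (sum)
  import Data.Nat.Properties as ℕ
  open import Algebra.Properties.CommutativeSemigroup ℕ.+-commutativeSemigroup
    using () renaming (interchange to +-interchange)
  open import Algebra.Properties.CommutativeMonoid.Sum ℕ.+-0-commutativeMonoid
    using (sum-remove; sum-cong-≗; ∑-distrib-+) renaming (sum to ∑)
  open import Data.Nat.Solver using (module +-*-Solver)
  open import Data.Product using (Σ; ∃-syntax; _×_; _,_; proj₁; proj₂)
  open import Data.Sum using (_⊎_; inj₁; inj₂)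
  open import Data.Vec using (Vec; []; _∷_; lookup; replicate; _[_]≔_)
  import Data.Vec as Vec
  open import Data.Vec.Properties
    using ( lookup∘update; lookup∘update′; []≔-idempotent; []≔-lookup; lookup-replicate; lookup∘tabulate
          ; tabulate-cong; ≡-dec)
  open import Function using (_∘_; mk⇔)
  open import Relation.Binary.Construct.Closure.ReflexiveTransitive using (Star; ε; _◅_)
  open import Relation.Binary.PropositionalEquality
  open import Relation.Nullary using (Dec; yes; no; does; ¬_; contradiction)
  open import Relation.Nullary.Decidable using (_×-dec_; ¬?; dec-true; dec-false)
  open import Relation.Unary using (Decidable)
  open import Relation.Binary using (DecidableEquality)
  open +-*-Solver using (solve; _:=_; _:+_; _:*_; con)

  module _ {A : Set} where

    Unique⇒lookup-injective : ∀ {xs : List A} → Unique xs → ∀ i j → List.lookup xs i ≡ List.lookup xs j → i ≡ j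
    Unique⇒lookup-injective (_  ∷ _) zero    zero    _  = refl
    Unique⇒lookup-injective (x∉ ∷ _) zero    (suc j) eq = contradiction eq (All.lookup x∉ (∈-lookup j))
    Unique⇒lookup-injective (x∉ ∷ _) (suc i) zero    eq = contradiction (sym eq) (All.lookup x∉ (∈-lookup i))
    Unique⇒lookup-injective (_  ∷ u) (suc i) (suc j) eq = cong suc (Unique⇒lookup-injective u i j eq)

    Unique-⊆⇒length≤ : ∀ {xs ys : List A} → Unique xs → xs ⊆ ys → length xs ≤ length ys
    Unique-⊆⇒length≤ u xs⊆ys = injective⇒≤ λ {i} {j} eq →
      Unique⇒lookup-injective u i j (index-injective (setoid A) (xs⊆ys (∈-lookup i)) (xs⊆ys (∈-lookup j)) eq)

    length*≤sum : ∀ (f : A → ℕ) c xs → (∀ {x} → x ∈ xs → c ≤ f x) → length xs * c ≤ sum (map f xs)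
    length*≤sum f c []       _  = z≤n
    length*≤sum f c (x ∷ xs) c≤ = ℕ.+-mono-≤ (c≤ (here refl)) (length*≤sum f c xs (c≤ ∘ there))

    sum≤length* : ∀ (f : A → ℕ) c xs → (∀ {x} → x ∈ xs → f x ≤ c) → sum (map f xs) ≤ length xs * c
    sum≤length* f c []       _  = z≤n
    sum≤length* f c (x ∷ xs) ≤c = ℕ.+-mono-≤ (≤c (here refl)) (sum≤length* f c xs (≤c ∘ there))

    sum-map-≤-+ : ∀ (f g : A → ℕ) c xs → (∀ {x} → x ∈ xs → f x ≤ c + g x) →
                  sum (map f xs) ≤ length xs * c + sum (map g xs)
    sum-map-≤-+ f g c []       _  = z≤n
    sum-map-≤-+ f g c (x ∷ xs) ≤+ = begin
      f x + sum (map f xs)                         ≤⟨ ℕ.+-mono-≤ (≤+ (here refl)) (sum-map-≤-+ f g c xs (≤+ ∘ there)) ⟩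
      (c + g x) + (length xs * c + sum (map g xs)) ≡⟨ +-interchange c (g x) _ _ ⟩
      (c + length xs * c) + (g x + sum (map g xs)) ∎
      where open ℕ.≤-Reasoning

    length-filter-≤-split : ∀ {P Q : A → Set} (P? : Decidable P) (Q? : Decidable Q) xs →
      length (filter P? xs) ≤ length (filter Q? xs) + length (filter (λ x → P? x ×-dec ¬? (Q? x)) xs)
    length-filter-≤-split P? Q? [] = z≤n
    length-filter-≤-split P? Q? (x ∷ xs) with P? x | Q? x | length-filter-≤-split P? Q? xs
    ... | yes _ | yes _ | ih = s≤s ih
    ... | yes _ | no  _ | ih = ℕ.≤-trans (s≤s ih) (ℕ.≤-reflexive (sym (ℕ.+-suc _ _)))
    ... | no  _ | yes _ | ih = ℕ.m≤n⇒m≤1+n ih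
    ... | no  _ | no  _ | ih = ih

  module _ {A B : Set} where

    ∈-concatMap⁺′ : ∀ (f : A → List B) {x y xs} → x ∈ xs → y ∈ f x → y ∈ concatMap f xs
    ∈-concatMap⁺′ f x∈xs y∈fx = ∈-concatMap⁺ f (Any.map (λ { refl → y∈fx }) x∈xs)

    length-concatMap : ∀ (f : A → List B) xs → length (concatMap f xs) ≡ sum (map (length ∘ f) xs)
    length-concatMap f []       = refl
    length-concatMap f (x ∷ xs) = trans (length-++ (f x)) (cong (length (f x) +_) (length-concatMap f xs))

    Unique-concatMap : ∀ {f : A → List B} {xs} (h : B → A) → Unique xs → (∀ {x} → x ∈ xs → Unique (f x)) →
                       (∀ {x y} → x ∈ xs → y ∈ f x → h y ≡ x) → Unique (concatMap f xs)
    Unique-concatMap h [] _ _ = []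
    Unique-concatMap {f} {x ∷ xs} h (x∉ ∷ u) uf hf =
      ++⁺ (uf (here refl)) (Unique-concatMap h u (uf ∘ there) (hf ∘ there)) disjoint
      where
      disjoint : Disjoint (f x) (concatMap f xs)
      disjoint (y∈fx , y∈rest) =
        let x′ , x′∈xs , y∈fx′ = find (∈-concatMap⁻ f y∈rest)
        in All.lookup x∉ x′∈xs (trans (sym (hf (here refl) y∈fx)) (hf (there x′∈xs) y∈fx′))

  module _ {A : Set} where

    []≔-injective : ∀ {k} (ψ : Vec A k) i {x y} → ψ [ i ]≔ x ≡ ψ [ i ]≔ y → x ≡ y
    []≔-injective ψ i {x} {y} eq = trans (sym (lookup∘update i ψ x)) (trans (cong (λ φ → lookup φ i) eq) (lookup∘update i ψ y))

    vectorsOver : List A → (k : ℕ) → List (Vec A k)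
    vectorsOver ws zero    = [] ∷ []
    vectorsOver ws (suc k) = concatMap (λ w → map (w ∷_) (vectorsOver ws k)) ws

    length-vectorsOver : ∀ ws k → length (vectorsOver ws k) ≡ length ws ^ k
    length-vectorsOver ws zero    = refl
    length-vectorsOver ws (suc k) = trans (length-concatMap _ ws) (rows ws)
      where
      rows : ∀ vs → sum (map (λ w → length (map (w ∷_) (vectorsOver ws k))) vs) ≡ length vs * length ws ^ k
      rows []       = refl
      rows (v ∷ vs) = cong₂ _+_ (trans (length-map _ (vectorsOver ws k)) (length-vectorsOver ws k)) (rows vs)

    ∈-vectorsOver : ∀ ws {k} (φ : Vec A k) → (∀ i → lookup φ i ∈ ws) → φ ∈ vectorsOver ws k
    ∈-vectorsOver ws []      _    = here refl
    ∈-vectorsOver ws (x ∷ φ) φ∈ws =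
      ∈-concatMap⁺′ _ (φ∈ws zero) (∈-map⁺ (x ∷_) (∈-vectorsOver ws φ (φ∈ws ∘ suc)))

  𝟙 : Bool → ℕ
  𝟙 b = if b then 1 else 0

  ∧-true : ∀ {a b} → a ∧ b ≡ true → a ≡ true × b ≡ true
  ∧-true {true} b≡true = refl , b≡true

  ∑-ones : ∀ n → ∑ {n} (λ _ → 1) ≡ n
  ∑-ones zero    = refl
  ∑-ones (suc n) = cong suc (∑-ones n)

  ∑-remove-point : ∀ {n} (g h : Fin n → ℕ) u → h u ≡ 0 → (∀ v → v ≢ u → g v ≡ h v) → ∑ g ≡ ∑ h + g u
  ∑-remove-point {suc n} g h u hu≡0 g≗h = begin
    ∑ g                             ≡⟨ sum-remove {i = u} g ⟩
    g u + ∑ (g ∘ punchIn u)         ≡⟨ cong (g u +_) (sum-cong-≗ (λ v → g≗h (punchIn u v) (punchInᵢ≢i u v))) ⟩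
    g u + ∑ (h ∘ punchIn u)         ≡⟨ cong (λ x → g u + (x + ∑ (h ∘ punchIn u))) (sym hu≡0) ⟩
    g u + (h u + ∑ (h ∘ punchIn u)) ≡⟨ cong (g u +_) (sym (sum-remove {i = u} h)) ⟩
    g u + ∑ h                       ≡⟨ ℕ.+-comm (g u) (∑ h) ⟩
    ∑ h + g u                       ∎
    where open ≡-Reasoning

  sum-map-tabulate : ∀ {A : Set} {n} (g : A → ℕ) (f : Fin n → A) → sum (map g (List.tabulate f)) ≡ ∑ (g ∘ f)
  sum-map-tabulate {n = zero}  g f = refl
  sum-map-tabulate {n = suc n} g f = cong (g (f zero) +_) (sum-map-tabulate g (f ∘ suc))

  sum-map-filter : ∀ {A : Set} (b : A → Bool) (f : A → ℕ) xs →
                   sum (map f (filter (λ x → b x Bool.≟ true) xs)) ≡ sum (map (λ x → if b x then f x else 0) xs)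
  sum-map-filter b f []       = refl
  sum-map-filter b f (x ∷ xs) with b x
  ... | true  = cong (f x +_) (sum-map-filter b f xs)
  ... | false = sum-map-filter b f xs

  length-filter≡sum-𝟙 : ∀ {A : Set} (b : A → Bool) xs → length (filter (λ x → b x Bool.≟ true) xs) ≡ sum (map (𝟙 ∘ b) xs)
  length-filter≡sum-𝟙 b []       = refl
  length-filter≡sum-𝟙 b (x ∷ xs) with b x
  ... | true  = cong suc (length-filter≡sum-𝟙 b xs)
  ... | false = length-filter≡sum-𝟙 b xs

  length-filter-allFin : ∀ {n} (b : Fin n → Bool) → length (filter (λ u → b u Bool.≟ true) (allFin n)) ≡ ∑ (𝟙 ∘ b)
  length-filter-allFin {n} b = trans (length-filter≡sum-𝟙 b (allFin n)) (sum-map-tabulate (𝟙 ∘ b) (λ u → u))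

  *-∸-bound : ∀ a d k b → a * d ≤ a * k + b → a * (d ∸ k) ≤ b
  *-∸-bound a d k b ad≤ = subst (_≤ b) (sym (ℕ.*-distribˡ-∸ a d k)) (ℕ.m≤n+o⇒m∸n≤o (a * d) (a * k) ad≤)

  -- Peeling

  module Peeling {m} (G : Digraph m) where

    VertexSet : Set
    VertexSet = Fin m → Bool

    delete : VertexSet → Fin m → VertexSet
    delete S u v with v ≟ u
    ... | yes _ = false
    ... | no  _ = S v

    delete-self : ∀ S u → delete S u u ≡ false
    delete-self S u with u ≟ u
    ... | yes _  = refl
    ... | no u≢u = contradiction refl u≢u

    delete-other : ∀ S u v → v ≢ u → delete S u v ≡ S v
    delete-other S u v v≢u with v ≟ u
    ... | yes v≡u = contradiction v≡u v≢u
    ... | no  _   = refl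

    ∣_∣ : VertexSet → ℕ
    ∣ S ∣ = ∑ (𝟙 ∘ S)

    outdeg : VertexSet → Fin m → ℕ
    outdeg R u = ∑ λ v → 𝟙 (R v ∧ adj G u v)

    indeg : VertexSet → Fin m → ℕ
    indeg L v = ∑ λ u → 𝟙 (L u ∧ adj G u v)

    e[_,_] : VertexSet → VertexSet → ℕ
    e[ L , R ] = ∑ λ u → if L u then outdeg R u else 0

    ∣delete∣ : ∀ S u → S u ≡ true → ∣ S ∣ ≡ suc ∣ delete S u ∣
    ∣delete∣ S u u∈S = begin
      ∣ S ∣                    ≡⟨ ∑-remove-point (𝟙 ∘ S) (𝟙 ∘ delete S u) u (cong 𝟙 (delete-self S u))
                                    (λ v v≢u → cong 𝟙 (sym (delete-other S u v v≢u))) ⟩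
      ∣ delete S u ∣ + 𝟙 (S u) ≡⟨ cong (λ b → ∣ delete S u ∣ + 𝟙 b) u∈S ⟩
      ∣ delete S u ∣ + 1       ≡⟨ ℕ.+-comm _ 1 ⟩
      suc ∣ delete S u ∣       ∎
      where open ≡-Reasoning

    outdeg-delete : ∀ R v u → R v ≡ true → outdeg R u ≡ outdeg (delete R v) u + 𝟙 (adj G u v)
    outdeg-delete R v u v∈R = begin
      outdeg R u                                  ≡⟨ ∑-remove-point _ _ v entry-deleted
                                                       (λ w w≢v → cong (λ b → 𝟙 (b ∧ adj G u w)) (sym (delete-other R v w w≢v))) ⟩
      outdeg (delete R v) u + 𝟙 (R v ∧ adj G u v) ≡⟨ cong (λ b → outdeg (delete R v) u + 𝟙 (b ∧ adj G u v)) v∈R ⟩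
      outdeg (delete R v) u + 𝟙 (adj G u v)       ∎
      where
      open ≡-Reasoning
      entry-deleted : 𝟙 (delete R v v ∧ adj G u v) ≡ 0
      entry-deleted rewrite delete-self R v = refl

    e-delete-left : ∀ L R u → L u ≡ true → e[ L , R ] ≡ e[ delete L u , R ] + outdeg R u
    e-delete-left L R u u∈L = begin
      e[ L , R ]                       ≡⟨ ∑-remove-point (row L) (row (delete L u)) u row-deleted
                                            (λ v v≢u → cong (λ b → if b then outdeg R v else 0) (sym (delete-other L u v v≢u))) ⟩
      e[ delete L u , R ] + row L u    ≡⟨ cong (λ b → e[ delete L u , R ] + (if b then outdeg R u else 0)) u∈L ⟩
      e[ delete L u , R ] + outdeg R u ∎
      where
      open ≡-Reasoning
      row : VertexSet → Fin m → ℕ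
      row L′ v = if L′ v then outdeg R v else 0
      row-deleted : row (delete L u) u ≡ 0
      row-deleted rewrite delete-self L u = refl

    e-delete-right : ∀ L R v → R v ≡ true → e[ L , R ] ≡ e[ L , delete R v ] + indeg L v
    e-delete-right L R v v∈R = trans (sum-cong-≗ split-row) (∑-distrib-+ (row (delete R v)) (λ u → 𝟙 (L u ∧ adj G u v)))
      where
      row : VertexSet → Fin m → ℕ
      row R′ u = if L u then outdeg R′ u else 0
      split-row : ∀ u → row R u ≡ row (delete R v) u + 𝟙 (L u ∧ adj G u v)
      split-row u with L u
      ... | true  = outdeg-delete R v u v∈R
      ... | false = refl

    MinDegree : ℕ → VertexSet → VertexSet → Set
    MinDegree d L R = (∀ u → L u ≡ true → d ≤ outdeg R u) × (∀ v → R v ≡ true → d ≤ indeg L v)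

    size-delete-left : ∀ L R u → L u ≡ true → ∣ L ∣ + ∣ R ∣ ≡ suc (∣ delete L u ∣ + ∣ R ∣)
    size-delete-left L R u u∈L = cong (_+ ∣ R ∣) (∣delete∣ L u u∈L)

    size-delete-right : ∀ L R v → R v ≡ true → ∣ L ∣ + ∣ R ∣ ≡ suc (∣ L ∣ + ∣ delete R v ∣)
    size-delete-right L R v v∈R = trans (cong (∣ L ∣ +_) (∣delete∣ R v v∈R)) (ℕ.+-suc _ _)

    deletion-bound : ∀ {x y} a d n → x ≤ a + d * n → y < d → x + y ≤ a + d * suc n
    deletion-bound {x} {y} a d n x≤ y<d = begin
      x + y             ≤⟨ ℕ.+-mono-≤ x≤ (ℕ.<⇒≤ y<d) ⟩
      a + d * n + d     ≡⟨ ℕ.+-assoc a (d * n) d ⟩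
      a + (d * n + d)   ≡⟨ cong (a +_) (trans (ℕ.+-comm (d * n) d) (sym (ℕ.*-suc d n))) ⟩
      a + d * suc n     ∎
      where open ℕ.≤-Reasoning

    peel : ∀ d n L R → ∣ L ∣ + ∣ R ∣ ≡ n →
           ∃[ L′ ] ∃[ R′ ] (MinDegree d L′ R′ × e[ L , R ] ≤ e[ L′ , R′ ] + d * n)
    peel d n L R size
      with any? (λ u → (L u Bool.≟ true) ×-dec (outdeg R u <? d))
         | any? (λ v → (R v Bool.≟ true) ×-dec (indeg L v <? d))
    ... | no ¬lowL | no ¬lowR =
      L , R , ((λ u u∈L → ℕ.≮⇒≥ λ low → ¬lowL (u , u∈L , low)) , (λ v v∈R → ℕ.≮⇒≥ λ low → ¬lowR (v , v∈R , low))) ,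
      ℕ.m≤m+n _ _
    peel d zero L R size | yes (u , u∈L , _) | _ = contradiction (trans (sym size) (size-delete-left L R u u∈L)) λ ()
    peel d (suc n) L R size | yes (u , u∈L , low) | _ =
      let L′ , R′ , min-degree , bound = peel d n (delete L u) R (ℕ.suc-injective (trans (sym (size-delete-left L R u u∈L)) size))
      in L′ , R′ , min-degree ,
         subst (_≤ e[ L′ , R′ ] + d * suc n) (sym (e-delete-left L R u u∈L)) (deletion-bound e[ L′ , R′ ] d n bound low)
    peel d zero L R size | no _ | yes (v , v∈R , _) = contradiction (trans (sym size) (size-delete-right L R v v∈R)) λ ()
    peel d (suc n) L R size | no _ | yes (v , v∈R , low) =
      let L′ , R′ , min-degree , bound = peel d n L (delete R v) (ℕ.suc-injective (trans (sym (size-delete-right L R v v∈R)) size))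
      in L′ , R′ , min-degree ,
         subst (_≤ e[ L′ , R′ ] + d * suc n) (sym (e-delete-right L R v v∈R)) (deletion-bound e[ L′ , R′ ] d n bound low)

    all : VertexSet
    all _ = true

    ∣all∣ : ∣ all ∣ ≡ m
    ∣all∣ = ∑-ones m

    e[all,all] : e[ all , all ] ≡ edgeCount G
    e[all,all] = sym (trans (sum-map-tabulate (λ u → sum (map (edge u) (allFin m))) (λ u → u))
                            (sum-cong-≗ λ u → sum-map-tabulate (edge u) (λ v → v)))
      where
      edge : Fin m → Fin m → ℕ
      edge u v = 𝟙 (adj G u v)

    min-degree-pair : ∀ d → ∃[ L ] ∃[ R ] (MinDegree d L R × edgeCount G ≤ e[ L , R ] + d * (m + m))
    min-degree-pair d =
      let L , R , min-degree , bound = peel d (m + m) all all (cong₂ _+_ ∣all∣ ∣all∣)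
      in L , R , min-degree , subst (_≤ e[ L , R ] + d * (m + m)) e[all,all] bound

  -- Search orders of a tree

  module _ {A : Set} where

    _⟨_≔_⟩ : (ℕ → A) → ℕ → A → ℕ → A
    (f ⟨ k ≔ x ⟩) i with i ℕ.≟ k
    ... | yes _ = x
    ... | no  _ = f i

    ≔-same : ∀ f k (x : A) → (f ⟨ k ≔ x ⟩) k ≡ x
    ≔-same f k x with k ℕ.≟ k
    ... | yes _   = refl
    ... | no  k≢k = contradiction refl k≢k

    ≔-other : ∀ f k (x : A) {i} → i < k → (f ⟨ k ≔ x ⟩) i ≡ f i
    ≔-other f k x {i} i<k with i ℕ.≟ k
    ... | yes i≡k = contradiction i≡k (ℕ.<⇒≢ i<k)
    ... | no  _   = refl

  UAdj-sym : ∀ {n} {T : Digraph n} {u v} → UAdj T u v → UAdj T v u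
  UAdj-sym (inj₁ uv) = inj₂ uv
  UAdj-sym (inj₂ vu) = inj₁ vu

  -- A search order of T from r cut off after k positions; σ and parent are junk at positions ≥ k.
  record SearchOrder {N} (T : Digraph N) (r : Fin N) (k : ℕ) : Set where
    field
      σ           : ℕ → Fin N
      parent      : ℕ → ℕ
      σ-root      : σ 0 ≡ r
      σ-injective : ∀ {i j} → i < k → j < k → σ i ≡ σ j → i ≡ j
      parent-<    : ∀ {i} → 0 < i → i < k → parent i < i
      parent-adj  : ∀ {i} → 0 < i → i < k → UAdj T (σ i) (σ (parent i))

  module _ {N} {T : Digraph N} {r : Fin N} where
    open SearchOrder

    Covered : ∀ {k} → SearchOrder T r k → Fin N → Set
    Covered {k} o x = ∃[ i ] σ o (toℕ {k} i) ≡ x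

    covered? : ∀ {k} (o : SearchOrder T r k) x → Dec (Covered o x)
    covered? o x = any? λ i → σ o (toℕ i) ≟ x

    Spanning : ∀ {k} → SearchOrder T r k → Set
    Spanning o = ∀ x → Covered o x

    ParentsUnique : SearchOrder T r N → Set
    ParentsUnique o = ∀ {i j} → j < i → i < N → UAdj T (σ o i) (σ o j) → j ≡ parent o i

    length≤ : ∀ {k} → SearchOrder T r k → k ≤ N
    length≤ o = injective⇒≤ λ {i} {j} eq → toℕ-injective (σ-injective o (toℕ<n i) (toℕ<n j) eq)

    Spanning⇒N≤ : ∀ {k} (o : SearchOrder T r k) → Spanning o → N ≤ k
    Spanning⇒N≤ o span = injective⇒≤ λ {x} {y} eq →
      trans (sym (proj₂ (span x))) (trans (cong (σ o ∘ toℕ) eq) (proj₂ (span y)))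

  module _ {N} (T : Digraph N) (r : Fin N) where
    open SearchOrder

    root-order : SearchOrder T r 1
    root-order = record
      { σ = λ _ → r ; parent = λ _ → 0 ; σ-root = refl
      ; σ-injective = λ { (s≤s z≤n) (s≤s z≤n) _ → refl }
      ; parent-< = λ { () (s≤s z≤n) } ; parent-adj = λ { () (s≤s z≤n) } }

    extend : ∀ {k} (o : SearchOrder T r k) → 0 < k → ∀ x → ¬ Covered o x →
             ∀ {j} → j < k → UAdj T x (σ o j) → SearchOrder T r (suc k)
    extend {k} o 0<k x x∉ {j} j<k x~j = record
      { σ = σ′ ; parent = parent′
      ; σ-root = trans (≔-other (σ o) k x 0<k) (σ-root o)
      ; σ-injective = injective′ ; parent-< = parent-<′ ; parent-adj = parent-adj′ }
      where
      σ′ = σ o ⟨ k ≔ x ⟩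
      parent′ = parent o ⟨ k ≔ j ⟩
      new : ∀ {i} → i < k → σ′ i ≢ σ′ k
      new {i} i<k eq = x∉ (fromℕ< i<k , trans (cong (σ o) (toℕ-fromℕ< i<k))
                           (trans (sym (≔-other (σ o) k x i<k)) (trans eq (≔-same (σ o) k x))))
      injective′ : ∀ {i i′} → i < suc k → i′ < suc k → σ′ i ≡ σ′ i′ → i ≡ i′
      injective′ {i} {i′} i<sk i′<sk eq with ℕ.m<1+n⇒m<n∨m≡n i<sk | ℕ.m<1+n⇒m<n∨m≡n i′<sk
      ... | inj₂ refl | inj₂ refl = refl
      ... | inj₁ i<k  | inj₂ refl = contradiction eq (new i<k)
      ... | inj₂ refl | inj₁ i′<k = contradiction (sym eq) (new i′<k)
      ... | inj₁ i<k  | inj₁ i′<k = σ-injective o i<k i′<k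
        (trans (sym (≔-other (σ o) k x i<k)) (trans eq (≔-other (σ o) k x i′<k)))
      parent-<′ : ∀ {i} → 0 < i → i < suc k → parent′ i < i
      parent-<′ {i} 0<i i<sk with ℕ.m<1+n⇒m<n∨m≡n i<sk
      ... | inj₂ refl = subst (_< i) (sym (≔-same (parent o) i j)) j<k
      ... | inj₁ i<k  = subst (_< i) (sym (≔-other (parent o) k j i<k)) (parent-< o 0<i i<k)
      parent-adj′ : ∀ {i} → 0 < i → i < suc k → UAdj T (σ′ i) (σ′ (parent′ i))
      parent-adj′ {i} 0<i i<sk with ℕ.m<1+n⇒m<n∨m≡n i<sk
      ... | inj₂ refl = subst₂ (UAdj T) (sym (≔-same (σ o) i x))
                          (sym (trans (cong σ′ (≔-same (parent o) i j)) (≔-other (σ o) i x j<k))) x~j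
      ... | inj₁ i<k  = subst₂ (UAdj T) (sym (≔-other (σ o) k x i<k))
                          (sym (trans (cong σ′ (≔-other (parent o) k j i<k))
                                      (≔-other (σ o) k x (ℕ.<-trans (parent-< o 0<i i<k) i<k))))
                          (parent-adj o 0<i i<k)

    frontier : ∀ {k} (o : SearchOrder T r k) {a b} → Star (UAdj T) a b → Covered o a → ¬ Covered o b →
               ∃[ x ] ¬ Covered o x × ∃[ j ] (j < k × UAdj T x (σ o j))
    frontier o ε a∈ b∉ = contradiction a∈ b∉
    frontier o (_◅_ {j = c} a~c path) (i , σi≡a) b∉ with covered? o c
    ... | yes c∈ = frontier o path c∈ b∉
    ... | no  c∉ = c , c∉ , toℕ i , toℕ<n i , subst (UAdj T c) (sym σi≡a) (UAdj-sym {T = T} a~c)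

    grow : (∀ u v → Star (UAdj T) u v) → ∀ fuel {k} → k + fuel ≡ N → 0 < k → SearchOrder T r k →
           Σ (SearchOrder T r N) Spanning
    grow conn fuel {k} k+fuel≡N 0<k o with all? (covered? o)
    ... | yes span = subst (λ k → Σ (SearchOrder T r k) Spanning) (ℕ.≤-antisym (length≤ o) (Spanning⇒N≤ o span)) (o , span)
    ... | no ¬span =
      let c , c∉ = ¬∀⟶∃¬ N (Covered o) (covered? o) ¬span
          r∈ = fromℕ< 0<k , trans (cong (σ o) (toℕ-fromℕ< 0<k)) (σ-root o)
          x , x∉ , j , j<k , x~j = frontier o (conn r c) r∈ c∉
      in grow-extended fuel k+fuel≡N (extend o 0<k x x∉ j<k x~j)
      where
      grow-extended : ∀ fuel → k + fuel ≡ N → SearchOrder T r (suc k) → Σ (SearchOrder T r N) Spanning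
      grow-extended zero    k+0≡N o′ = contradiction (length≤ o′)
        (subst (λ n → ¬ suc n ≤ N) (sym (trans (sym (ℕ.+-identityʳ k)) k+0≡N)) ℕ.1+n≰n)
      grow-extended (suc f) k+sf≡N o′ = grow conn f (trans (sym (ℕ.+-suc k f)) k+sf≡N) (s≤s z≤n) o′

  spanning-order : ∀ {n} (T : Digraph (suc n)) r → (∀ u v → Star (UAdj T) u v) →
                   Σ (SearchOrder T r (suc n)) Spanning
  spanning-order {n} T r conn = grow T r conn n refl (s≤s z≤n) (root-order T r)

  module _ {n} (G : Digraph n) where

    out-edges : Fin n → List (Fin n × Fin n)
    out-edges u = map (u ,_) (filter (λ v → adj G u v Bool.≟ true) (allFin n))

    edgeList : List (Fin n × Fin n)
    edgeList = concatMap out-edges (allFin n)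

    length-edgeList : length edgeList ≡ edgeCount G
    length-edgeList = trans (length-concatMap out-edges (allFin n)) (cong sum (map-cong length-out-edges (allFin n)))
      where
      length-out-edges : ∀ u → length (out-edges u) ≡ sum (map (𝟙 ∘ adj G u) (allFin n))
      length-out-edges u = trans (length-map (u ,_) (filter (λ v → adj G u v Bool.≟ true) (allFin n)))
                                 (length-filter≡sum-𝟙 (adj G u) (allFin n))

    ∈-edgeList : ∀ {u v} → Edge G u v → (u , v) ∈ edgeList
    ∈-edgeList {u} {v} uv = ∈-concatMap⁺′ out-edges (∈-allFin u) (∈-map⁺ (u ,_) (∈-filter⁺ _ (∈-allFin v) uv))

    length≤edgeCount : ∀ {ps} → Unique ps → (∀ {p} → p ∈ ps → Edge G (proj₁ p) (proj₂ p)) → length ps ≤ edgeCount G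
    length≤edgeCount unique edges = subst (_ ≤_) length-edgeList (Unique-⊆⇒length≤ unique (∈-edgeList ∘ edges))

    orient : Fin n → Fin n → Fin n × Fin n
    orient u v with adj G u v
    ... | true  = u , v
    ... | false = v , u

    orient-edge : ∀ {u v} → UAdj G u v → Edge G (proj₁ (orient u v)) (proj₂ (orient u v))
    orient-edge {u} {v} u~v with adj G u v in uv
    ... | true = uv
    orient-edge (inj₁ ()) | false
    orient-edge (inj₂ vu) | false = vu

    orient-injective : ∀ {u v u′ v′} → orient u v ≡ orient u′ v′ → (u ≡ u′ × v ≡ v′) ⊎ (u ≡ v′ × v ≡ u′)
    orient-injective {u} {v} {u′} {v′} eq with adj G u v | adj G u′ v′
    ... | true  | true  = inj₁ (cong proj₁ eq , cong proj₂ eq)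
    ... | true  | false = inj₂ (cong proj₁ eq , cong proj₂ eq)
    ... | false | true  = inj₂ (cong proj₂ eq , cong proj₁ eq)
    ... | false | false = inj₁ (cong proj₂ eq , cong proj₁ eq)

  -- Otherwise the n parent edges and the edge between σ i and σ j would be n + 1 distinct edges of T.
  parents-unique : ∀ {n} (T : Digraph (suc n)) {r} (o : SearchOrder T r (suc n)) → edgeCount T ≡ n → ParentsUnique o
  parents-unique {n} T o edges {i} {j} j<i i<sn i~j with j ℕ.≟ SearchOrder.parent o i
  ... | yes j≡pi = j≡pi
  ... | no  j≢pi = contradiction (length≤edgeCount T unique all-edges)
                     (subst₂ (λ l e → ¬ suc l ≤ e) (sym (length-tabulate parent-edge)) (sym edges) ℕ.1+n≰n)
    where
    open SearchOrder
    position : Fin n → ℕ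
    position a = suc (toℕ a)
    position< : ∀ a → position a < suc n
    position< a = s≤s (toℕ<n a)
    parent<position : ∀ a → parent o (position a) < position a
    parent<position a = parent-< o (s≤s z≤n) (position< a)
    parent<sn : ∀ a → parent o (position a) < suc n
    parent<sn a = ℕ.<-trans (parent<position a) (position< a)
    parent-edge : Fin n → Fin (suc n) × Fin (suc n)
    parent-edge a = orient T (σ o (position a)) (σ o (parent o (position a)))
    parent-edge-injective : ∀ {a b} → parent-edge a ≡ parent-edge b → a ≡ b
    parent-edge-injective {a} {b} eq with orient-injective T eq
    ... | inj₁ (σa≡σb , _) = toℕ-injective (ℕ.suc-injective (σ-injective o (position< a) (position< b) σa≡σb))
    ... | inj₂ (σa≡σpb , σpa≡σb) =
      let a≡pb = σ-injective o (position< a) (parent<sn b) σa≡σpb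
          pa≡b = σ-injective o (parent<sn a) (position< b) σpa≡σb
      in contradiction (subst (_< position a) pa≡b (parent<position a))
                       (ℕ.<-asym (subst (_< position b) (sym a≡pb) (parent<position b)))
    j<sn : j < suc n
    j<sn = ℕ.<-trans j<i i<sn
    extra≢parent-edge : ∀ a → orient T (σ o i) (σ o j) ≢ parent-edge a
    extra≢parent-edge a eq with orient-injective T eq
    ... | inj₁ (σi≡σa , σj≡σpa) =
      j≢pi (trans (σ-injective o j<sn (parent<sn a) σj≡σpa) (cong (parent o) (sym (σ-injective o i<sn (position< a) σi≡σa))))
    ... | inj₂ (σi≡σpa , σj≡σa) =
      ℕ.<-asym j<i (subst₂ _<_ (sym (σ-injective o i<sn (parent<sn a) σi≡σpa)) (sym (σ-injective o j<sn (position< a) σj≡σa))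
                              (parent<position a))
    ps : List (Fin (suc n) × Fin (suc n))
    ps = orient T (σ o i) (σ o j) ∷ List.tabulate parent-edge
    unique : Unique ps
    unique = All.tabulate⁺ extra≢parent-edge ∷ tabulate⁺ parent-edge-injective
    all-edges : ∀ {p} → p ∈ ps → Edge T (proj₁ p) (proj₂ p)
    all-edges (here refl) = orient-edge T i~j
    all-edges (there p∈) with ∈-tabulate⁻ p∈
    ... | a , refl = orient-edge T (parent-adj o (s≤s z≤n) (position< a))

  -- Counting embeddings greedily

  module _ {n m} (T : Digraph n) (G : Digraph m) where

    IsEmbedding : Vec (Fin m) n → Set
    IsEmbedding φ = (∀ x y → Edge T x y → Edge G (lookup φ x) (lookup φ y)) × (∀ x y → lookup φ x ≡ lookup φ y → x ≡ y)

  module _ {n} (T : Digraph n) where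

    source : Fin n → Bool
    source x = does (any? λ y → adj T x y Bool.≟ true)

    source-tail : ∀ {x y} → Edge T x y → source x ≡ true
    source-tail {x} {y} xy with any? (λ z → adj T x z Bool.≟ true)
    ... | yes _   = refl
    ... | no  ¬xz = contradiction (y , xy) ¬xz

    source-head : NoDirectedP2 T → ∀ {x y} → Edge T x y → source y ≡ false
    source-head noP2 {x} {y} xy with any? (λ z → adj T y z Bool.≟ true)
    ... | yes (z , yz) = contradiction yz (noP2 x y z xy)
    ... | no  _        = refl

  module Greedy {n m} (T : Digraph n) (noP2 : NoDirectedP2 T)
                {r} (o : SearchOrder T r n) (parents-unique : ParentsUnique o) (root-source : ∃[ y ] Edge T r y)
                (G : Digraph m) (w₀ : Fin m) (d : ℕ) (L R : Fin m → Bool) (min-degree : Peeling.MinDegree G d L R) where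

    open SearchOrder o
    open Peeling G using (outdeg; indeg; e[_,_])
    open import Data.List.Membership.DecPropositional (_≟_ {m}) using (_∈?_)

    allowed : Fin n → Fin m → Bool
    allowed x w = if source T x then L w else R w

    _at_ : Vec (Fin m) n → ℕ → Fin m
    ψ at i = lookup ψ (σ i)

    -- ψ assigns an image to every vertex of T; the vertices σ k, σ (k + 1), … not yet placed
    -- are sent to w₀, so that placing σ k can be undone and extensions of distinct ψ differ.
    record Partial (k : ℕ) (ψ : Vec (Fin m) n) : Set where
      field
        unplaced        : ∀ {i} → k ≤ i → i < n → ψ at i ≡ w₀
        allowed-image   : ∀ {i} → i < k → allowed (σ i) (ψ at i) ≡ true
        preserves-edges : ∀ {i j} → i < k → j < k → Edge T (σ i) (σ j) → Edge G (ψ at i) (ψ at j)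
        injective       : ∀ {i j} → i < k → j < k → ψ at i ≡ ψ at j → i ≡ j
    open Partial

    σ-distinct : ∀ {i j} → i < n → j < n → i ≢ j → σ i ≢ σ j
    σ-distinct i<n j<n i≢j = i≢j ∘ σ-injective i<n j<n

    module Step (k : ℕ) (0<k : 0 < k) (k<n : k < n) where

      p : ℕ
      p = parent k

      p<k : p < k
      p<k = parent-< 0<k k<n

      -- By ParentsUnique, σ p is the only earlier neighbour of σ k; the edge between them
      -- leaves σ k exactly when σ k is a source.
      candidate : Vec (Fin m) n → Fin m → Bool
      candidate ψ w = if source T (σ k) then L w ∧ adj G w (ψ at p) else R w ∧ adj G (ψ at p) w

      degree : Vec (Fin m) n → ℕ
      degree ψ = length (filter (λ w → candidate ψ w Bool.≟ true) (allFin m))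

      used : Vec (Fin m) n → List (Fin m)
      used ψ = map (ψ at_) (upTo k)

      fresh-candidate? : ∀ ψ w → Dec (candidate ψ w ≡ true × w ∉ used ψ)
      fresh-candidate? ψ w = (candidate ψ w Bool.≟ true) ×-dec ¬? (w ∈? used ψ)

      candidates : Vec (Fin m) n → List (Fin m)
      candidates ψ = filter (fresh-candidate? ψ) (allFin m)

      extensions : Vec (Fin m) n → List (Vec (Fin m) n)
      extensions ψ = map (ψ [ σ k ]≔_) (candidates ψ)

      degree≤ : ∀ ψ → degree ψ ≤ k + length (candidates ψ)
      degree≤ ψ = ℕ.≤-trans (length-filter-≤-split (λ w → candidate ψ w Bool.≟ true) (_∈? used ψ) (allFin m))
                            (ℕ.+-monoˡ-≤ _ used≤k)
        where
        used≤k : length (filter (_∈? used ψ) (allFin m)) ≤ k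
        used≤k = subst (length (filter (_∈? used ψ) (allFin m)) ≤_) (trans (length-map (ψ at_) (upTo k)) (length-upTo k))
                   (Unique-⊆⇒length≤ (filter⁺ (_∈? used ψ) (allFin⁺ m)) (proj₂ ∘ ∈-filter⁻ (_∈? used ψ) {xs = allFin m}))

      candidate-source : ∀ {ψ w} → source T (σ k) ≡ true → candidate ψ w ≡ true → L w ≡ true × Edge G w (ψ at p)
      candidate-source {ψ} {w} src cand rewrite src = ∧-true cand

      candidate-sink : ∀ {ψ w} → source T (σ k) ≡ false → candidate ψ w ≡ true → R w ≡ true × Edge G (ψ at p) w
      candidate-sink {ψ} {w} snk cand rewrite snk = ∧-true cand

      candidate-allowed : ∀ {ψ w} → candidate ψ w ≡ true → allowed (σ k) w ≡ true
      candidate-allowed with source T (σ k)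
      ... | true  = proj₁ ∘ ∧-true
      ... | false = proj₁ ∘ ∧-true

      extension-Partial : ∀ {ψ} → Partial k ψ → ∀ {ψ′} → ψ′ ∈ extensions ψ → Partial (suc k) ψ′
      extension-Partial {ψ} inv ψ′∈ with ∈-map⁻ (ψ [ σ k ]≔_) ψ′∈
      ... | w , w∈ , refl = record
        { unplaced = λ {i} sk≤i i<n → trans (at-other i<n (ℕ.<⇒≢ sk≤i ∘ sym)) (unplaced inv (ℕ.<⇒≤ sk≤i) i<n)
        ; allowed-image = allowed′ ; preserves-edges = edges′ ; injective = injective′ }
        where
        ψ′ : Vec (Fin m) n
        ψ′ = ψ [ σ k ]≔ w
        cand : candidate ψ w ≡ true
        cand = proj₁ (proj₂ (∈-filter⁻ (fresh-candidate? ψ) {xs = allFin m} w∈))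
        fresh : w ∉ used ψ
        fresh = proj₂ (proj₂ (∈-filter⁻ (fresh-candidate? ψ) {xs = allFin m} w∈))
        at-k : ψ′ at k ≡ w
        at-k = lookup∘update (σ k) ψ w
        at-other : ∀ {i} → i < n → i ≢ k → ψ′ at i ≡ ψ at i
        at-other i<n i≢k = lookup∘update′ (σ-distinct i<n k<n i≢k) ψ w
        at-old : ∀ {i} → i < k → ψ′ at i ≡ ψ at i
        at-old i<k = at-other (ℕ.<-trans i<k k<n) (ℕ.<⇒≢ i<k)
        fresh′ : ∀ {i} → i < k → ψ at i ≢ w
        fresh′ i<k eq = fresh (subst (_∈ used ψ) eq (∈-map⁺ (ψ at_) (∈-upTo⁺ i<k)))
        allowed′ : ∀ {i} → i < suc k → allowed (σ i) (ψ′ at i) ≡ true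
        allowed′ i<sk with ℕ.m<1+n⇒m<n∨m≡n i<sk
        ... | inj₂ refl = trans (cong (allowed (σ k)) at-k) (candidate-allowed {ψ} cand)
        ... | inj₁ i<k  = trans (cong (allowed (σ _)) (at-old i<k)) (allowed-image inv i<k)
        edges′ : ∀ {i j} → i < suc k → j < suc k → Edge T (σ i) (σ j) → Edge G (ψ′ at i) (ψ′ at j)
        edges′ i<sk j<sk e with ℕ.m<1+n⇒m<n∨m≡n i<sk | ℕ.m<1+n⇒m<n∨m≡n j<sk
        ... | inj₂ refl | inj₂ refl = contradiction (trans (sym e) (loopless T (σ k))) λ ()
        ... | inj₂ refl | inj₁ j<k  rewrite parents-unique j<k k<n (inj₁ e) =
          subst₂ (Edge G) (sym at-k) (sym (at-old p<k)) (proj₂ (candidate-source {ψ} (source-tail T e) cand))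
        ... | inj₁ i<k  | inj₂ refl rewrite parents-unique i<k k<n (inj₂ e) =
          subst₂ (Edge G) (sym (at-old p<k)) (sym at-k) (proj₂ (candidate-sink {ψ} (source-head T noP2 e) cand))
        ... | inj₁ i<k  | inj₁ j<k  = subst₂ (Edge G) (sym (at-old i<k)) (sym (at-old j<k)) (preserves-edges inv i<k j<k e)
        injective′ : ∀ {i j} → i < suc k → j < suc k → ψ′ at i ≡ ψ′ at j → i ≡ j
        injective′ i<sk j<sk eq with ℕ.m<1+n⇒m<n∨m≡n i<sk | ℕ.m<1+n⇒m<n∨m≡n j<sk
        ... | inj₂ refl | inj₂ refl = refl
        ... | inj₂ refl | inj₁ j<k  = contradiction (trans (sym (at-old j<k)) (trans (sym eq) at-k)) (fresh′ j<k)
        ... | inj₁ i<k  | inj₂ refl = contradiction (trans (sym (at-old i<k)) (trans eq at-k)) (fresh′ i<k)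
        ... | inj₁ i<k  | inj₁ j<k  = injective inv i<k j<k (trans (sym (at-old i<k)) (trans eq (at-old j<k)))

      degree-min : ∀ {ψ} → Partial k ψ → d ≤ degree ψ
      degree-min {ψ} inv rewrite length-filter-allFin (candidate ψ) with source T (σ k) in src | parent-adj 0<k k<n
      ... | true  | inj₁ e = proj₂ min-degree (ψ at p)
        (subst (λ b → (if b then L (ψ at p) else R (ψ at p)) ≡ true) (source-head T noP2 e) (allowed-image inv p<k))
      ... | true  | inj₂ e = contradiction (trans (sym src) (source-head T noP2 e)) λ ()
      ... | false | inj₁ e = contradiction (trans (sym src) (source-tail T e)) λ ()
      ... | false | inj₂ e = proj₁ min-degree (ψ at p)
        (subst (λ b → (if b then L (ψ at p) else R (ψ at p)) ≡ true) (source-tail T e) (allowed-image inv p<k))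

      extensions-Unique : ∀ ψ → Unique (extensions ψ)
      extensions-Unique ψ = map⁺ ([]≔-injective ψ (σ k)) (filter⁺ _ (allFin⁺ m))

      extension-restore : ∀ {ψ} → Partial k ψ → ∀ {ψ′} → ψ′ ∈ extensions ψ → ψ′ [ σ k ]≔ w₀ ≡ ψ
      extension-restore {ψ} inv ψ′∈ with ∈-map⁻ (ψ [ σ k ]≔_) ψ′∈
      ... | w , _ , refl = trans ([]≔-idempotent ψ (σ k))
                                 (subst (λ x → ψ [ σ k ]≔ x ≡ ψ) (unplaced inv ℕ.≤-refl k<n) ([]≔-lookup ψ (σ k)))

      step : ∀ {Ls} → Unique Ls → (∀ {ψ} → ψ ∈ Ls → Partial k ψ) →
             ∃[ Ls′ ] (Unique Ls′ × (∀ {ψ} → ψ ∈ Ls′ → Partial (suc k) ψ) × sum (map degree Ls) ≤ length Ls * k + length Ls′)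
      step {Ls} unique inv =
        concatMap extensions Ls ,
        Unique-concatMap (_[ σ k ]≔ w₀) unique (λ {ψ} _ → extensions-Unique ψ) (λ ψ∈ → extension-restore (inv ψ∈)) ,
        (λ ψ′∈ → let _ , ψ∈ , ψ′∈ext = find (∈-concatMap⁻ extensions ψ′∈) in extension-Partial (inv ψ∈) ψ′∈ext) ,
        subst (sum (map degree Ls) ≤_) (cong (length Ls * k +_) (sym length-extensions))
              (sum-map-≤-+ degree (length ∘ candidates) k Ls (λ {ψ} _ → degree≤ ψ))
        where
        length-extensions : length (concatMap extensions Ls) ≡ sum (map (length ∘ candidates) Ls)
        length-extensions = trans (length-concatMap extensions Ls) (cong sum (map-cong (λ ψ → length-map _ (candidates ψ)) Ls))

    base : Vec (Fin m) n
    base = replicate n w₀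

    roots : List (Vec (Fin m) n)
    roots = map (base [ σ 0 ]≔_) (filter (λ w → L w Bool.≟ true) (allFin m))

    roots-Unique : Unique roots
    roots-Unique = map⁺ ([]≔-injective base (σ 0)) (filter⁺ _ (allFin⁺ m))

    length-roots : length roots ≤ m
    length-roots = subst (length roots ≤_) (length-tabulate {n = m} (λ u → u))
      (subst (_≤ length (allFin m)) (sym (length-map _ (filter (λ w → L w Bool.≟ true) (allFin m))))
        (length-filter _ (allFin m)))

    source-root : source T (σ 0) ≡ true
    source-root = source-tail T (subst (λ x → Edge T x (proj₁ root-source)) (sym σ-root) (proj₂ root-source))

    roots-Partial : ∀ {ψ} → ψ ∈ roots → Partial 1 ψ
    roots-Partial ψ∈ with ∈-map⁻ (base [ σ 0 ]≔_) ψ∈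
    ... | w , w∈ , refl = record
      { unplaced = λ {i} 0<i i<n → trans (lookup∘update′ (σ-distinct i<n (ℕ.<-trans 0<i i<n) (ℕ.<⇒≢ 0<i ∘ sym)) base w)
                                         (lookup-replicate (σ i) w₀)
      ; allowed-image = λ { (s≤s z≤n) → trans (cong (λ b → if b then L _ else R _) source-root)
                                              (trans (cong L (lookup∘update (σ 0) base w)) (proj₂ (∈-filter⁻ _ {xs = allFin m} w∈))) }
      ; preserves-edges = λ { (s≤s z≤n) (s≤s z≤n) e → contradiction (trans (sym e) (loopless T (σ 0))) λ () }
      ; injective = λ { (s≤s z≤n) (s≤s z≤n) _ → refl } }

    module _ (1<n : 1 < n) where
      open Step 1 (s≤s z≤n) 1<n using () renaming (degree to degree₁; candidate to candidate₁; step to step₁)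

      parent₁ : parent 1 ≡ 0
      parent₁ = ℕ.n<1⇒n≡0 (parent-< (s≤s z≤n) 1<n)

      source₁ : source T (σ 1) ≡ false
      source₁ with subst (λ i → UAdj T (σ 1) (σ i)) parent₁ (parent-adj (s≤s z≤n) 1<n)
      ... | inj₁ e = contradiction (trans (sym source-root) (source-head T noP2 e)) λ ()
      ... | inj₂ e = source-head T noP2 e

      degree-root : ∀ w → degree₁ (base [ σ 0 ]≔ w) ≡ outdeg R w
      degree-root w
        rewrite length-filter-allFin (candidate₁ (base [ σ 0 ]≔ w)) | source₁ | parent₁ | lookup∘update (σ 0) base w = refl

      sum-degree-roots : sum (map degree₁ roots) ≡ e[ L , R ]
      sum-degree-roots = begin
        sum (map degree₁ roots)                      ≡⟨ cong sum (sym (map-∘ Lfilt)) ⟩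
        sum (map (degree₁ ∘ (base [ σ 0 ]≔_)) Lfilt) ≡⟨ cong sum (map-cong degree-root Lfilt) ⟩
        sum (map (outdeg R) Lfilt)                   ≡⟨ sum-map-filter L (outdeg R) (allFin m) ⟩
        sum (map row (allFin m))                     ≡⟨ sum-map-tabulate row (λ u → u) ⟩
        e[ L , R ]                                   ∎
        where
        open ≡-Reasoning
        row : Fin m → ℕ
        row u = if L u then outdeg R u else 0
        Lfilt : List (Fin m)
        Lfilt = filter (λ w → L w Bool.≟ true) (allFin m)

      stage : ∀ j → 2 + j ≤ n →
              ∃[ Ls ] (Unique Ls × (∀ {ψ} → ψ ∈ Ls → Partial (2 + j) ψ) × (e[ L , R ] ∸ m) * (d ∸ n) ^ j ≤ length Ls)
      stage zero _ =
        let Ls , unique , inv , bound = step₁ roots-Unique roots-Partial in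
        Ls , unique , inv , (begin
          (e[ L , R ] ∸ m) * 1 ≡⟨ ℕ.*-identityʳ _ ⟩
          e[ L , R ] ∸ m       ≤⟨ ℕ.m≤n+o⇒m∸n≤o e[ L , R ] m (begin
            e[ L , R ]                 ≡⟨ sym sum-degree-roots ⟩
            sum (map degree₁ roots)    ≤⟨ bound ⟩
            length roots * 1 + length Ls ≤⟨ ℕ.+-monoˡ-≤ (length Ls) (ℕ.≤-trans (ℕ.≤-reflexive (ℕ.*-identityʳ _)) length-roots) ⟩
            m + length Ls              ∎) ⟩
          length Ls            ∎)
        where open ℕ.≤-Reasoning
      stage (suc j) 3+j≤n =
        let Ls , unique , inv , bound = stage j (ℕ.≤-trans (ℕ.n≤1+n _) 3+j≤n)
            open Step (2 + j) (s≤s z≤n) 3+j≤n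
            Ls′ , unique′ , inv′ , bound′ = step unique inv
        in Ls′ , unique′ , inv′ , (begin
          (e[ L , R ] ∸ m) * ((d ∸ n) * (d ∸ n) ^ j) ≡⟨ cong ((e[ L , R ] ∸ m) *_) (ℕ.*-comm (d ∸ n) _) ⟩
          (e[ L , R ] ∸ m) * ((d ∸ n) ^ j * (d ∸ n)) ≡⟨ sym (ℕ.*-assoc (e[ L , R ] ∸ m) _ _) ⟩
          (e[ L , R ] ∸ m) * (d ∸ n) ^ j * (d ∸ n)   ≤⟨ ℕ.*-monoˡ-≤ (d ∸ n) bound ⟩
          length Ls * (d ∸ n)                        ≤⟨ ℕ.*-monoʳ-≤ (length Ls) (ℕ.∸-monoʳ-≤ d (ℕ.<⇒≤ 3+j≤n)) ⟩
          length Ls * (d ∸ (2 + j))                  ≤⟨ *-∸-bound (length Ls) d (2 + j) (length Ls′)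
                                                          (ℕ.≤-trans (length*≤sum degree d Ls (degree-min ∘ inv)) bound′) ⟩
          length Ls′                                 ∎)
        where open ℕ.≤-Reasoning

    Partial⇒IsEmbedding : Spanning o → ∀ {ψ} → Partial n ψ → IsEmbedding T G ψ
    Partial⇒IsEmbedding span {ψ} inv = edges , injective′
      where
      position : Fin n → ℕ
      position x = toℕ (proj₁ (span x))
      position< : ∀ x → position x < n
      position< x = toℕ<n (proj₁ (span x))
      σ-position : ∀ x → σ (position x) ≡ x
      σ-position x = proj₂ (span x)
      edges : ∀ x y → Edge T x y → Edge G (lookup ψ x) (lookup ψ y)
      edges x y e = subst₂ (λ x y → Edge G (lookup ψ x) (lookup ψ y)) (σ-position x) (σ-position y)
        (preserves-edges inv (position< x) (position< y) (subst₂ (Edge T) (sym (σ-position x)) (sym (σ-position y)) e))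
      injective′ : ∀ x y → lookup ψ x ≡ lookup ψ y → x ≡ y
      injective′ x y eq = trans (sym (σ-position x)) (trans (cong σ (injective inv (position< x) (position< y)
        (subst₂ (λ x y → lookup ψ x ≡ lookup ψ y) (sym (σ-position x)) (sym (σ-position y)) eq))) (σ-position y))

    embeddings : Spanning o → ∀ n₂ → 2 + n₂ ≡ n →
                 ∃[ Ls ] (Unique Ls × (∀ {φ} → φ ∈ Ls → IsEmbedding T G φ) × (e[ L , R ] ∸ m) * (d ∸ n) ^ n₂ ≤ length Ls)
    embeddings span n₂ refl =
      let Ls , unique , inv , bound = stage (s≤s (s≤s z≤n)) n₂ ℕ.≤-refl
      in Ls , unique , Partial⇒IsEmbedding span ∘ inv , bound

  -- From embeddings to copies

  from-does : ∀ {A : Set} (a? : Dec A) → does a? ≡ true → A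
  from-does (yes a) _ = a

  module _ {n m} (T : Digraph n) (G : Digraph m) where

    image? : (φ : Vec (Fin m) n) (v : Fin m) → Dec (∃[ x ] lookup φ x ≡ v)
    image? φ v = any? λ x → lookup φ x ≟ v

    edgeImage? : (φ : Vec (Fin m) n) (u v : Fin m) → Dec (∃[ x ] ∃[ y ] (lookup φ x ≡ u × lookup φ y ≡ v × Edge T x y))
    edgeImage? φ u v = any? λ x → any? λ y → (lookup φ x ≟ u) ×-dec ((lookup φ y ≟ v) ×-dec (adj T x y Bool.≟ true))

    toCopy : (φ : Vec (Fin m) n) → IsEmbedding T G φ → Copy T G
    toCopy φ (hom , inj) = record
      { W      = does ∘ image? φ
      ; F      = λ u v → does (edgeImage? φ u v)
      ; sub    = λ u v uv → let x , y , φx≡u , φy≡v , xy = from-does (edgeImage? φ u v) uv in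
                   subst₂ (Edge G) φx≡u φy≡v (hom x y xy) , dec-true (image? φ u) (x , φx≡u) , dec-true (image? φ v) (y , φy≡v)
      ; φ      = lookup φ
      ; φ-inj  = inj
      ; φ-onto = λ v → mk⇔ (from-does (image? φ v)) (dec-true (image? φ v))
      ; φ-iso  = iso }
      where
      iso : ∀ x y → does (edgeImage? φ (lookup φ x) (lookup φ y)) ≡ adj T x y
      iso x y with adj T x y in xy
      ... | true  = dec-true (edgeImage? φ (lookup φ x) (lookup φ y)) (x , y , refl , refl , xy)
      ... | false = dec-false (edgeImage? φ (lookup φ x) (lookup φ y)) λ (x′ , y′ , eqx , eqy , x′y′) →
                      contradiction (trans (sym x′y′) (trans (cong₂ (adj T) (inj x′ x eqx) (inj y′ y eqy)) xy)) λ ()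

    imageVec : Vec (Fin m) n → Vec Bool m
    imageVec φ = Vec.tabulate (does ∘ image? φ)

    fiber-bound : ∀ {W φs} → Unique φs → (∀ {φ} → φ ∈ φs → imageVec φ ≡ W) → length φs ≤ n ^ n
    fiber-bound {W} {[]} _ _ = z≤n
    fiber-bound {W} {φ₀ ∷ φs} unique fiber = begin
      length (φ₀ ∷ φs)              ≤⟨ Unique-⊆⇒length≤ unique (λ φ∈ → ∈-vectorsOver members _ (entries-in-members φ∈)) ⟩
      length (vectorsOver members n) ≡⟨ length-vectorsOver members n ⟩
      length members ^ n            ≤⟨ ℕ.^-monoˡ-≤ n members≤n ⟩
      n ^ n                         ∎
      where
      open ℕ.≤-Reasoning
      members : List (Fin m)
      members = filter (λ v → lookup W v Bool.≟ true) (allFin m)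
      in-W : ∀ {φ} → φ ∈ φ₀ ∷ φs → ∀ v → lookup W v ≡ does (image? φ v)
      in-W {φ} φ∈ v = trans (cong (λ W′ → lookup W′ v) (sym (fiber φ∈))) (lookup∘tabulate _ v)
      entries-in-members : ∀ {φ} → φ ∈ φ₀ ∷ φs → ∀ x → lookup φ x ∈ members
      entries-in-members {φ} φ∈ x = ∈-filter⁺ _ (∈-allFin (lookup φ x)) (trans (in-W φ∈ (lookup φ x)) (dec-true (image? φ (lookup φ x)) (x , refl)))
      members≤n : length members ≤ n
      members≤n = subst (length members ≤_) (trans (length-map (lookup φ₀) (allFin n)) (length-tabulate {n = n} (λ x → x)))
        (Unique-⊆⇒length≤ (filter⁺ _ (allFin⁺ m)) λ {v} v∈ →
          let x , φ₀x≡v = from-does (image? φ₀ v) (trans (sym (in-W (here refl) v)) (proj₂ (∈-filter⁻ _ {xs = allFin m} v∈)))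
          in subst (_∈ map (lookup φ₀) (allFin n)) φ₀x≡v (∈-map⁺ (lookup φ₀) (∈-allFin x)))

    copies-from-embeddings : ∀ {φs} → Unique φs → (∀ {φ} → φ ∈ φs → IsEmbedding T G φ) →
                             ∃[ K ] (AtLeastCopies K T G × length φs ≤ K * n ^ n)
    copies-from-embeddings {φs} unique emb = length images , (copy , distinct) , (begin
      length φs                              ≤⟨ Unique-⊆⇒length≤ unique (λ {φ} φ∈ →
                                                  ∈-concatMap⁺′ fiber (∈-deduplicate⁺ _≟ᵥ_ (∈-map⁺ imageVec φ∈)) (∈-filter⁺ _ φ∈ refl)) ⟩
      length (concatMap fiber images)        ≡⟨ length-concatMap fiber images ⟩
      sum (map (length ∘ fiber) images)      ≤⟨ sum≤length* (length ∘ fiber) (n ^ n) images (λ _ →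
                                                  fiber-bound (filter⁺ _ unique) (proj₂ ∘ ∈-filter⁻ _ {xs = φs})) ⟩
      length images * n ^ n                  ∎)
      where
      open ℕ.≤-Reasoning
      _≟ᵥ_ : DecidableEquality (Vec Bool m)
      _≟ᵥ_ = ≡-dec Bool._≟_
      images : List (Vec Bool m)
      images = deduplicate _≟ᵥ_ (map imageVec φs)
      fiber : Vec Bool m → List (Vec (Fin m) n)
      fiber W = filter (λ φ → imageVec φ ≟ᵥ W) φs
      representative : ∀ i → ∃[ φ ] (φ ∈ φs × List.lookup images i ≡ imageVec φ)
      representative i = ∈-map⁻ imageVec (∈-deduplicate⁻ _≟ᵥ_ (map imageVec φs) (∈-lookup i))
      copy : Fin (length images) → Copy T G
      copy i = let φ , φ∈ , _ = representative i in toCopy φ (emb φ∈)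
      distinct : ∀ i j → SameSubgraph (copy i) (copy j) → i ≡ j
      distinct i j (sameW , _) = Unique⇒lookup-injective (deduplicate-! _≟ᵥ_ (map imageVec φs)) i j
        (trans (proj₂ (proj₂ (representative i))) (trans (tabulate-cong sameW) (sym (proj₂ (proj₂ (representative j))))))

  ^-distribʳ-* : ∀ m n k → (m * n) ^ k ≡ m ^ k * n ^ k
  ^-distribʳ-* m n zero    = refl
  ^-distribʳ-* m n (suc k) = begin
    m * n * (m * n) ^ k       ≡⟨ cong (m * n *_) (^-distribʳ-* m n k) ⟩
    m * n * (m ^ k * n ^ k)   ≡⟨ solve 4 (λ m n a b → m :* n :* (a :* b) := m :* a :* (n :* b)) refl m n (m ^ k) (n ^ k) ⟩
    m * m ^ k * (n * n ^ k)   ∎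
    where open ≡-Reasoning

  2N<d : ∀ m N E d → 8 * m * suc (2 * N) ≤ E → E < 8 * m * suc d → 2 * N < d
  2N<d m N E d lower upper = s≤s⁻¹ (ℕ.*-cancelˡ-< (8 * m) (suc (2 * N)) (suc d) (ℕ.≤-<-trans lower upper))

  E≤16m[d∸N] : ∀ m N E d → 2 * N < d → E < 8 * m * suc d → E ≤ 16 * m * (d ∸ N)
  E≤16m[d∸N] m N E d 2N<d upper = begin
    E                        ≤⟨ ℕ.<⇒≤ upper ⟩
    8 * m * suc d            ≤⟨ ℕ.*-monoʳ-≤ (8 * m) sd≤2[d∸N] ⟩
    8 * m * (2 * (d ∸ N))    ≡⟨ solve 2 (λ m x → con 8 :* m :* (con 2 :* x) := con 16 :* m :* x) refl m (d ∸ N) ⟩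
    16 * m * (d ∸ N)         ∎
    where
    open ℕ.≤-Reasoning
    N+N<d : N + N < d
    N+N<d = subst (_< d) (cong (N +_) (ℕ.+-identityʳ N)) 2N<d
    d≡ : d ∸ N + N ≡ d
    d≡ = ℕ.m∸n+n≡m (ℕ.≤-trans (ℕ.m≤m+n N N) (ℕ.<⇒≤ N+N<d))
    N<d∸N : N < d ∸ N
    N<d∸N = ℕ.+-cancelʳ-< N N (d ∸ N) (subst (N + N <_) (sym d≡) N+N<d)
    sd≤2[d∸N] : suc d ≤ 2 * (d ∸ N)
    sd≤2[d∸N] = begin
      suc d                    ≡⟨ cong suc (sym d≡) ⟩
      suc (d ∸ N + N)          ≡⟨ sym (ℕ.+-suc (d ∸ N) N) ⟩
      d ∸ N + suc N            ≤⟨ ℕ.+-monoʳ-≤ (d ∸ N) N<d∸N ⟩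
      d ∸ N + (d ∸ N)          ≡⟨ cong (d ∸ N +_) (sym (ℕ.+-identityʳ (d ∸ N))) ⟩
      2 * (d ∸ N)              ∎

  E≤2[e∸m] : ∀ m E d e → 0 < d → 8 * m * d ≤ E → E ≤ e + d * (m + m) → E ≤ 2 * (e ∸ m)
  E≤2[e∸m] m E d e 0<d lower upper = subst (E ≤_) (sym (ℕ.*-distribˡ-∸ 2 e m))
    (subst (_≤ 2 * e ∸ 2 * m) (ℕ.m+n∸n≡m E (2 * m)) (ℕ.∸-monoˡ-≤ (2 * m) E+2m≤2e))
    where
    open ℕ.≤-Reasoning
    X : ℕ
    X = d * m
    m≤X : m ≤ X
    m≤X = subst (_≤ X) (ℕ.*-identityˡ m) (ℕ.*-monoˡ-≤ m 0<d)
    -- 2m ≤ 2X ≤ E/4, while 2e ≥ 2E − 4X ≥ 3E/2.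
    E+2m≤2e : E + 2 * m ≤ 2 * e
    E+2m≤2e = ℕ.+-cancelʳ-≤ (4 * X) (E + 2 * m) (2 * e) (begin
      E + 2 * m + 4 * X         ≤⟨ ℕ.+-monoˡ-≤ (4 * X) (ℕ.+-monoʳ-≤ E (ℕ.*-monoʳ-≤ 2 m≤X)) ⟩
      E + 2 * X + 4 * X         ≡⟨ solve 2 (λ E X → E :+ con 2 :* X :+ con 4 :* X := E :+ con 6 :* X) refl E X ⟩
      E + 6 * X                 ≤⟨ ℕ.+-monoʳ-≤ E (ℕ.*-monoˡ-≤ X {6} {8} (s≤s (s≤s (s≤s (s≤s (s≤s (s≤s z≤n))))))) ⟩
      E + 8 * X                 ≡⟨ cong (E +_) (solve 2 (λ m d → con 8 :* (d :* m) := con 8 :* m :* d) refl m d) ⟩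
      E + 8 * m * d             ≤⟨ ℕ.+-monoʳ-≤ E lower ⟩
      E + E                     ≤⟨ ℕ.+-mono-≤ upper upper ⟩
      (e + d * (m + m)) + (e + d * (m + m))
                                ≡⟨ solve 3 (λ e d m → (e :+ d :* (m :+ m)) :+ (e :+ d :* (m :+ m)) := con 2 :* e :+ con 4 :* (d :* m))
                                         refl e d m ⟩
      2 * e + 4 * X             ∎)

  power-bound : ∀ n₂ m N E d e K Ls → E ≤ 2 * (e ∸ m) → E ≤ 16 * m * (d ∸ N) →
                (e ∸ m) * (d ∸ N) ^ n₂ ≤ Ls → Ls ≤ K * N ^ N →
                E ^ suc n₂ ≤ 2 * 16 ^ n₂ * N ^ N * K * m ^ n₂
  power-bound n₂ m N E d e K Ls E≤e E≤d count≤ Ls≤ = begin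
    E * E ^ n₂                                      ≤⟨ ℕ.*-mono-≤ E≤e (ℕ.^-monoˡ-≤ n₂ E≤d) ⟩
    2 * (e ∸ m) * (16 * m * (d ∸ N)) ^ n₂           ≡⟨ cong (2 * (e ∸ m) *_) expand ⟩
    2 * (e ∸ m) * (16 ^ n₂ * m ^ n₂ * (d ∸ N) ^ n₂) ≡⟨ solve 4 (λ a P Q R → con 2 :* a :* (P :* Q :* R) := con 2 :* P :* Q :* (a :* R))
                                                               refl (e ∸ m) (16 ^ n₂) (m ^ n₂) ((d ∸ N) ^ n₂) ⟩
    2 * 16 ^ n₂ * m ^ n₂ * ((e ∸ m) * (d ∸ N) ^ n₂) ≤⟨ ℕ.*-monoʳ-≤ (2 * 16 ^ n₂ * m ^ n₂) (ℕ.≤-trans count≤ Ls≤) ⟩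
    2 * 16 ^ n₂ * m ^ n₂ * (K * N ^ N)              ≡⟨ solve 4 (λ P Q K W → con 2 :* P :* Q :* (K :* W) := con 2 :* P :* W :* K :* Q)
                                                               refl (16 ^ n₂) (m ^ n₂) K (N ^ N) ⟩
    2 * 16 ^ n₂ * N ^ N * K * m ^ n₂                ∎
    where
    open ℕ.≤-Reasoning
    expand : (16 * m * (d ∸ N)) ^ n₂ ≡ 16 ^ n₂ * m ^ n₂ * (d ∸ N) ^ n₂
    expand = trans (^-distribʳ-* (16 * m) (d ∸ N) n₂) (cong (_* (d ∸ N) ^ n₂) (^-distribʳ-* 16 m n₂))

open Counting

open import Defs
open import Algebra.Bundles using (CommutativeMonoid)
open import Data.Empty using (⊥-elim)
open import Data.Fin using (Fin; zero; suc)
open import Data.Integer as ℤ using (+_; +≤+)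
import Data.Integer.Properties as ℤ
open import Data.List using (map; allFin; length)
open import Data.List.Properties using (length-map; length-tabulate)
open import Data.List.Membership.Propositional using (_∈_)
open import Data.List.Relation.Unary.Unique.Propositional using (Unique)
open import Data.List.Relation.Unary.Unique.Propositional.Properties using (map⁺; allFin⁺)
open import Data.Nat as ℕ using (ℕ; zero; suc; _≥_; z≤n; s≤s)
import Data.Nat.DivMod as ℕ
import Data.Nat.Properties as ℕ
open import Data.Nat.Coprimality using (1-coprimeTo)
import Data.Nat.Coprimality as Coprime
open import Data.Product using (∃-syntax; _×_; _,_; proj₁; proj₂)
open import Data.Rational using (ℚ; 0ℚ; 1ℚ; mkℚ; _*_; _<_; _≤_; *≤*; 1/_; Positive; NonNegative)
import Data.Rational as ℚ
import Data.Rational.Properties as ℚ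
open import Data.Sum using (inj₁; inj₂)
open import Data.Vec using ([]; _∷_)
open import Algebra.Properties.CommutativeSemigroup (CommutativeMonoid.commutativeSemigroup ℚ.*-1-commutativeMonoid)
  using () renaming (interchange to *-interchange)
open import Relation.Binary.Construct.Closure.ReflexiveTransitive using (Star; ε; _◅_)
open import Relation.Binary.PropositionalEquality
open import Relation.Nullary using (contradiction)

ℕtoℚ≡mkℚ : ∀ k → ℕtoℚ k ≡ mkℚ (+ k) 0 (Coprime.sym (1-coprimeTo k))
ℕtoℚ≡mkℚ k = ℚ.normalize-coprime (Coprime.sym (1-coprimeTo k))

ℕtoℚ-* : ∀ a b → ℕtoℚ (a ℕ.* b) ≡ ℕtoℚ a * ℕtoℚ b
ℕtoℚ-* a b rewrite ℕtoℚ≡mkℚ a | ℕtoℚ≡mkℚ b = cong (ℚ._/ 1) (ℤ.pos-* a b)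

ℕtoℚ-^ : ∀ a k → ℕtoℚ (a ℕ.^ k) ≡ ℕtoℚ a ^ℚ k
ℕtoℚ-^ a zero    = refl
ℕtoℚ-^ a (suc k) = trans (ℕtoℚ-* a (a ℕ.^ k)) (cong (ℕtoℚ a *_) (ℕtoℚ-^ a k))

ℕtoℚ-mono-≤ : ∀ {a b} → a ℕ.≤ b → ℕtoℚ a ≤ ℕtoℚ b
ℕtoℚ-mono-≤ {a} {b} a≤b rewrite ℕtoℚ≡mkℚ a | ℕtoℚ≡mkℚ b =
  *≤* (subst₂ ℤ._≤_ (sym (ℤ.*-identityʳ (+ a))) (sym (ℤ.*-identityʳ (+ b))) (+≤+ a≤b))

ℕtoℚ-cancel-≤ : ∀ {a b} → ℕtoℚ a ≤ ℕtoℚ b → a ℕ.≤ b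
ℕtoℚ-cancel-≤ {a} {b} a≤b rewrite ℕtoℚ≡mkℚ a | ℕtoℚ≡mkℚ b with a≤b
... | *≤* a≤b′ = ℤ.drop‿+≤+ (subst₂ ℤ._≤_ (ℤ.*-identityʳ (+ a)) (ℤ.*-identityʳ (+ b)) a≤b′)

ℕtoℚ-nonNeg : ∀ a → NonNegative (ℕtoℚ a)
ℕtoℚ-nonNeg a = ℚ.normalize-nonNeg a 1

ℕtoℚ-pos : ∀ a .{{_ : ℕ.NonZero a}} → Positive (ℕtoℚ a)
ℕtoℚ-pos a = ℚ.normalize-pos a 1

^ℚ-distribʳ-* : ∀ x y k → (x * y) ^ℚ k ≡ (x ^ℚ k) * (y ^ℚ k)
^ℚ-distribʳ-* x y zero    = refl
^ℚ-distribʳ-* x y (suc k) = trans (cong (x * y *_) (^ℚ-distribʳ-* x y k)) (*-interchange x y (x ^ℚ k) (y ^ℚ k))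

module _ (C : ℕ) where

  private instance
    C+1-pos : Positive (ℕtoℚ (suc C))
    C+1-pos = ℕtoℚ-pos (suc C)
    C+1-nonZero : ℚ.NonZero (ℕtoℚ (suc C))
    C+1-nonZero = ℚ.pos⇒nonZero (ℕtoℚ (suc C))

  1/[1+_] : ℚ
  1/[1+_] = 1/ ℕtoℚ (suc C)

  1/[1+]-pos : 0ℚ < 1/[1+_]
  1/[1+]-pos = ℚ.positive⁻¹ 1/[1+_] {{ℚ.1/pos⇒pos (ℕtoℚ (suc C))}}

  rescale-bound : ∀ (F : ℚ) m E K n₂ → ℕtoℚ E ≡ F * ℕtoℚ (suc m) →
                  E ℕ.^ suc n₂ ℕ.≤ suc C ℕ.* K ℕ.* suc m ℕ.^ n₂ →
                  1/[1+_] * (F ^ℚ suc n₂) * ℕtoℚ (suc m) ≤ ℕtoℚ K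
  rescale-bound F m E K n₂ E≡Fm bound = begin
    1/[1+_] * F ^ℚ suc n₂ * ℕtoℚ (suc m)               ≡⟨ ℚ.*-assoc 1/[1+_] _ _ ⟩
    1/[1+_] * (F ^ℚ suc n₂ * ℕtoℚ (suc m))             ≤⟨ ℚ.*-monoˡ-≤-nonNeg 1/[1+_] {{ℚ.pos⇒nonNeg 1/[1+_] {{ℚ.1/pos⇒pos (ℕtoℚ (suc C))}}}}
                                                            (ℚ.*-cancelʳ-≤-pos P {{P-pos}} (subst₂ _≤_ lhs rhs (ℕtoℚ-mono-≤ bound))) ⟩
    1/[1+_] * (ℕtoℚ (suc C) * ℕtoℚ K)                  ≡⟨ sym (ℚ.*-assoc 1/[1+_] _ _) ⟩
    1/[1+_] * ℕtoℚ (suc C) * ℕtoℚ K                    ≡⟨ cong (_* ℕtoℚ K) (ℚ.*-inverseˡ (ℕtoℚ (suc C))) ⟩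
    1ℚ * ℕtoℚ K                                        ≡⟨ ℚ.*-identityˡ (ℕtoℚ K) ⟩
    ℕtoℚ K                                             ∎
    where
    open ℚ.≤-Reasoning
    P : ℚ
    P = ℕtoℚ (suc m) ^ℚ n₂
    P-pos : Positive P
    P-pos = subst Positive (ℕtoℚ-^ (suc m) n₂) (ℕtoℚ-pos (suc m ℕ.^ n₂) {{ℕ.m^n≢0 (suc m) n₂}})
    lhs : ℕtoℚ (E ℕ.^ suc n₂) ≡ (F ^ℚ suc n₂ * ℕtoℚ (suc m)) * P
    lhs = trans (ℕtoℚ-^ E (suc n₂)) (trans (cong (_^ℚ suc n₂) E≡Fm)
                (trans (^ℚ-distribʳ-* F (ℕtoℚ (suc m)) (suc n₂)) (sym (ℚ.*-assoc (F ^ℚ suc n₂) (ℕtoℚ (suc m)) P))))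
    rhs : ℕtoℚ (suc C ℕ.* K ℕ.* suc m ℕ.^ n₂) ≡ (ℕtoℚ (suc C) * ℕtoℚ K) * P
    rhs = trans (ℕtoℚ-* (suc C ℕ.* K) (suc m ℕ.^ n₂)) (cong₂ _*_ (ℕtoℚ-* (suc C) K) (ℕtoℚ-^ (suc m) n₂))


module _ {n₂} (T : Digraph (suc (suc n₂))) (tree : IsDirectedTree T) (noP2 : NoDirectedP2 T) where

  private
    N : ℕ
    N = suc (suc n₂)

    connected : ∀ u v → Star (UAdj T) u v
    connected = proj₁ (proj₂ (proj₂ tree))

    edges : edgeCount T ≡ suc n₂
    edges = proj₂ (proj₂ (proj₂ tree))

  constant : ℕ
  constant = 2 ℕ.* 16 ℕ.^ n₂ ℕ.* N ℕ.^ N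

  -- Average degree at least this forces d > 2N, so that each greedy step keeps d − N
  -- fresh candidates with d − N ≥ d/2.
  threshold : ℕ
  threshold = 8 ℕ.* suc (2 ℕ.* N)

  some-edge : ∃[ x ] ∃[ y ] Edge T x y
  some-edge = first-edge (connected zero (suc zero)) λ ()
    where
    first-edge : ∀ {a b} → Star (UAdj T) a b → a ≢ b → ∃[ x ] ∃[ y ] Edge T x y
    first-edge ε             a≢a = ⊥-elim (a≢a refl)
    first-edge (inj₁ ab ◅ _) _   = _ , _ , ab
    first-edge (inj₂ ba ◅ _) _   = _ , _ , ba

  copies-lower-bound : ∀ {m} (G : Digraph (suc m)) (F : ℚ) → ℕtoℚ (edgeCount G) ≡ F * ℕtoℚ (suc m) →
                       ℕtoℚ threshold ≤ F →
                       ∃[ K ] (AtLeastCopies K T G × 1/[1+ constant ] * (F ^ℚ suc n₂) * ℕtoℚ (suc m) ≤ ℕtoℚ K)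
  copies-lower-bound {m′} G F E≡Fm threshold≤F =
    let L , R , min-degree , E≤e+2dm = Peeling.min-degree-pair G d
        e = Peeling.e[_,_] G L R
        x , y , xy = some-edge
        o , span = spanning-order T x connected
        Ls , unique , embedding , many = Greedy.embeddings T noP2 o (parents-unique T o edges) (y , xy)
                                           G zero d L R min-degree span n₂ refl
        K , copies , Ls≤ = copies-from-embeddings T G unique embedding
        E^t≤ = power-bound n₂ m N E d e K (length Ls)
                 (E≤2[e∸m] m E d e (ℕ.≤-trans (s≤s z≤n) d>2N) 8md≤E E≤e+2dm)
                 (E≤16m[d∸N] m N E d d>2N E<8m[1+d]) many Ls≤
    in K , copies , rescale-bound constant F m′ E K n₂ E≡Fm
                      (ℕ.≤-trans E^t≤ (ℕ.*-monoˡ-≤ (m ℕ.^ n₂) (ℕ.*-monoˡ-≤ K (ℕ.n≤1+n constant))))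
    where
    m E d : ℕ
    m = suc m′
    E = edgeCount G
    d = E ℕ./ (8 ℕ.* m)
    8md≤E : 8 ℕ.* m ℕ.* d ℕ.≤ E
    8md≤E = subst (ℕ._≤ E) (ℕ.*-comm d (8 ℕ.* m)) (ℕ.m/n*n≤m E (8 ℕ.* m))
    E<8m[1+d] : E ℕ.< 8 ℕ.* m ℕ.* suc d
    E<8m[1+d] = subst₂ ℕ._<_ (sym (ℕ.m≡m%n+[m/n]*n E (8 ℕ.* m))) (ℕ.*-comm (suc d) (8 ℕ.* m))
                  (ℕ.+-monoˡ-< (d ℕ.* (8 ℕ.* m)) (ℕ.m%n<n E (8 ℕ.* m)))
    threshold≤E : 8 ℕ.* m ℕ.* suc (2 ℕ.* N) ℕ.≤ E
    threshold≤E = subst (ℕ._≤ E) reorder (ℕtoℚ-cancel-≤ (subst₂ _≤_ (sym (ℕtoℚ-* threshold m)) (sym E≡Fm)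
                    (ℚ.*-monoʳ-≤-nonNeg (ℕtoℚ m) {{ℕtoℚ-nonNeg m}} threshold≤F)))
      where
      reorder : threshold ℕ.* m ≡ 8 ℕ.* m ℕ.* suc (2 ℕ.* N)
      reorder = trans (ℕ.*-assoc 8 (suc (2 ℕ.* N)) m)
                      (trans (cong (8 ℕ.*_) (ℕ.*-comm (suc (2 ℕ.* N)) m)) (sym (ℕ.*-assoc 8 m (suc (2 ℕ.* N)))))
    d>2N : 2 ℕ.* N ℕ.< d
    d>2N = 2N<d m N E d threshold≤E E<8m[1+d]

single-vertex-copies : ∀ {m} (T : Digraph 1) (G : Digraph m) (F : ℚ) →
                       ∃[ K ] (AtLeastCopies K T G × 1ℚ * (F ^ℚ 0) * ℕtoℚ m ≤ ℕtoℚ K)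
single-vertex-copies {m} T G F =
  let K , copies , m≤K*1 = copies-from-embeddings T G unique embedding
      m≤K = subst₂ ℕ._≤_ (trans (length-map _ (allFin m)) (length-tabulate {n = m} (λ u → u))) (ℕ.*-identityʳ K) m≤K*1
  in K , copies , subst (_≤ ℕtoℚ K) (sym (trans (cong (_* ℕtoℚ m) (ℚ.*-identityˡ 1ℚ)) (ℚ.*-identityˡ (ℕtoℚ m))))
                    (ℕtoℚ-mono-≤ m≤K)
  where
  unique : Unique (map (_∷ []) (allFin m))
  unique = map⁺ (λ { refl → refl }) (allFin⁺ m)
  embedding : ∀ {φ} → φ ∈ map (_∷ []) (allFin m) → IsEmbedding T G φ
  embedding _ = (λ { zero zero e → contradiction (trans (sym e) (loopless T zero)) λ () }) , λ { zero zero _ → refl }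

lemma3p1 : ∀ {n} (T : Digraph n) (t : ℕ) → IsDirectedTree T → NoDirectedP2 T → edgeCount T ≡ t →
    ∃[ δ ] (0ℚ < δ ×
      ((f : ℕ → ℚ) → (G : (m : ℕ) → Digraph m) →
        (∀ (K : ℚ) → ∃[ M ] (∀ m → m ≥ M → K ≤ f m)) →
        (∀ m → ℕtoℚ (edgeCount (G m)) ≡ f m * ℕtoℚ m) →
        ∃[ M ] (∀ m → m ≥ M → ∃[ N ] (AtLeastCopies N T (G m) × δ * (f m ^ℚ t) * ℕtoℚ m ≤ ℕtoℚ N))))
lemma3p1 {zero} T t (() , _) _ _
lemma3p1 {suc zero} T t tree _ refl rewrite proj₂ (proj₂ (proj₂ tree)) =
  1ℚ , ℚ.positive⁻¹ 1ℚ , λ f G _ _ → 0 , λ m _ → single-vertex-copies T (G m) (f m)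
lemma3p1 {suc (suc n₂)} T t tree noP2 refl rewrite proj₂ (proj₂ (proj₂ tree)) =
  1/[1+ constant T tree noP2 ] , 1/[1+]-pos (constant T tree noP2) , λ f G f→∞ edges →
    let M , threshold≤f = f→∞ (ℕtoℚ (threshold T tree noP2))
    in suc M , λ { (suc m) M<m → copies-lower-bound T tree noP2 (G (suc m)) (f (suc m)) (edges (suc m))
                                   (threshold≤f (suc m) (ℕ.m≤n⇒m≤1+n (ℕ.s≤s⁻¹ M<m))) }
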